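{- Let $\mathcal{C}=(C,\chi,W,\ell)$ be a polychromatic model, $a$ an agent, $X\in W$, and $Y\in W$ with $Y\unlhd_a X$. Then for each $Z\in\mathsf{Min}_{\unlhd_a}(X)$ we have $Z\unlhd_a Y$.
   Context: A simplicial complex is a pair $C=(S,\mathcal{V})$ with $S\subseteq\mathcal{P}(\mathcal{V})\setminus\{\emptyset\}$ closed under nonempty subsets; $\mathcal{F}(C)$ is its set of inclusion-maximal elements. Fix a finite set of agents $\mathsf{Ag}$ and a set $\mathsf{Prop}$ of atomic propositions. A polychromatic model is $\mathcal{C}=(C,\chi,W,\ell)$ with $C=(S,\mathcal{V})$ a simplicial complex, $\chi:\mathcal{V}\to\mathsf{Ag}$ an arbitrary coloring, $\mathcal{F}(C)\subseteq W\subseteq S$, $\ell:W\to\mathcal{P}(\mathsf{Prop})$, satisfying: for all $X,Y,Z\in W$ and $G\subseteq\mathsf{Ag}$, $G\subseteq\chi(X\cap Y)$ and $G\subseteq\chi(Y\cap Z)$ imply $G\subseteq\chi(X\cap Z)$, where $\chi(U)=\{\chi(u)\mid u\in U\}$. Write $X\sim_a Y$ iff $a\in\chi(X\cap Y)$. Let $m_a(X)=|\{v\in X\mid\chi(v)=a\}|$. Define $X\unlhd_a Y$ iff $X\sim_a Y$ and $m_a(X)\le m_a(Y)$, and $X\lhd_a Y$ iff $X\sim_a Y$ and $m_a(X)< m_a(Y)$. Finally $\mathsf{Min}_{\unlhd_a}(X)=\{Y\in W\mid Y\sim_a X\text{ and there is no }Z\in W\text{ with }Z\lhd_a Y\}$.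 -}

module Defs where

open import Data.Nat using (ℕ; _≤_; _<_)
open import Data.Fin using (Fin; _≟_)
open import Data.Fin.Subset using (Subset) renaming (_∈_ to _∈ₛ_)
open import Data.List using (List; []; length; filter)
open import Data.List.Membership.Propositional using (_∈_)
open import Data.List.Relation.Binary.Subset.Propositional using (_⊆_)
open import Data.List.Relation.Unary.Unique.Propositional using (Unique)
open import Data.Product using (Σ; _×_; ∃)
open import Relation.Binary.PropositionalEquality using (_≡_; _≢_)
open import Relation.Nullary using (¬_)

-- A finite nonempty set of vertices is represented by a duplicate-free list.
-- A simplicial complex: a family S of nonempty finite vertex sets,
-- closed under nonempty subsets.
record SimplicialComplex (V : Set) : Set₁ where
  field
    S         : List V → Set
    S-unique  : ∀ X → S X → Unique X
    S-nonempt : ∀ X → S X → X ≢ []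
    S-closed  : ∀ X Y → S X → Unique Y → Y ≢ [] → Y ⊆ X → S Y

  IsFacet : List V → Set
  IsFacet X = S X × (∀ Y → S Y → X ⊆ Y → Y ⊆ X)

record PolyModel (nAg : ℕ) (Prop : Set) (V : Set) : Set₁ where
  field
    C  : SimplicialComplex V
  open SimplicialComplex C public
  field
    χ   : V → Fin nAg
    W   : List V → Set
    facet⊆W : ∀ X → IsFacet X → W X
    W⊆S     : ∀ X → W X → S X
    ℓ       : ∀ X → W X → Prop → Set

  colorIn : Fin nAg → List V → List V → Set
  colorIn a X Y = ∃ λ v → v ∈ X × v ∈ Y × χ v ≡ a

  _⊆χ∩_,_ : Subset nAg → List V → List V → Set
  G ⊆χ∩ X , Y = ∀ a → a ∈ₛ G → colorIn a X Y

  field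
    poly : ∀ X Y Z (G : Subset nAg) → W X → W Y → W Z →
           G ⊆χ∩ X , Y → G ⊆χ∩ Y , Z → G ⊆χ∩ X , Z

  _∼[_]_ : List V → Fin nAg → List V → Set
  X ∼[ a ] Y = colorIn a X Y

  m : Fin nAg → List V → ℕ
  m a X = length (filter (λ v → χ v ≟ a) X)

  _⊴[_]_ : List V → Fin nAg → List V → Set
  X ⊴[ a ] Y = X ∼[ a ] Y × m a X ≤ m a Y

  _◁[_]_ : List V → Fin nAg → List V → Set
  X ◁[ a ] Y = X ∼[ a ] Y × m a X < m a Y

  InMin : Fin nAg → List V → List V → Set
  InMin a X Y = W Y × Y ∼[ a ] X × (∀ Z → W Z → ¬ (Z ◁[ a ] Y))

{-# OPTIONS --safe #-}
module Submission where

open import Defs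
open import Data.Nat using (ℕ)
open import Data.Nat.Properties using (≮⇒≥)
open import Data.Fin using (Fin)
open import Data.Fin.Subset using (⁅_⁆)
open import Data.Fin.Subset.Properties using (x∈⁅x⁆; x∈⁅y⁆⇒x≡y)
open import Data.List using (List)
open import Data.Product using (_,_)
open import Relation.Binary.PropositionalEquality using (subst; sym)
open import Relation.Nullary using (¬_)

module _ {nAg : ℕ} {Prop V : Set} (M : PolyModel nAg Prop V) where
  open PolyModel M

  ∼-sym : ∀ {a X Y} → X ∼[ a ] Y → Y ∼[ a ] X
  ∼-sym (v , v∈X , v∈Y , χv≡a) = v , v∈Y , v∈X , χv≡a

  ∼⇒⁅⁆⊆χ∩ : ∀ {a X Y} → X ∼[ a ] Y → ⁅ a ⁆ ⊆χ∩ X , Y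
  ∼⇒⁅⁆⊆χ∩ {a} X∼Y b b∈⁅a⁆ = subst (λ c → colorIn c _ _) (sym (x∈⁅y⁆⇒x≡y a b∈⁅a⁆)) X∼Y

  ∼-trans : ∀ {a X Y Z} → W X → W Y → W Z → X ∼[ a ] Y → Y ∼[ a ] Z → X ∼[ a ] Z
  ∼-trans {a} {X} {Y} {Z} wX wY wZ X∼Y Y∼Z =
    poly X Y Z ⁅ a ⁆ wX wY wZ (∼⇒⁅⁆⊆χ∩ X∼Y) (∼⇒⁅⁆⊆χ∩ Y∼Z) a (x∈⁅x⁆ a)

  minimal⇒⊴ : ∀ {a Y Z} → W Y → (∀ U → W U → ¬ (U ◁[ a ] Z)) → Z ∼[ a ] Y → Z ⊴[ a ] Y
  minimal⇒⊴ wY minimal Z∼Y = Z∼Y , ≮⇒≥ (λ mY<mZ → minimal _ wY (∼-sym Z∼Y , mY<mZ))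

mainTheorem3 : ∀ {nAg : ℕ} {Prop V : Set} (M : PolyModel nAg Prop V) (a : Fin nAg)
                 (X Y Z : List V) →
                 PolyModel.W M X → PolyModel.W M Y →
                 PolyModel._⊴[_]_ M Y a X →
                 PolyModel.InMin M a X Z →
                 PolyModel._⊴[_]_ M Z a Y
mainTheorem3 M a X Y Z wX wY (Y∼X , _) (wZ , Z∼X , minimal) =
  minimal⇒⊴ M wY minimal (∼-trans M wZ wX wY Z∼X (∼-sym M Y∼X))
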